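{- If $G$ is a $(4,3,2)$-triangle in $K_3^{\mathbb{Z}_2\times\mathbb{Z}_2}$, then $\mathrm{FM}(G)$ has a submatroid isomorphic to $M(K_4)$.
   Context: $K_3^{\mathbb{Z}_2\times\mathbb{Z}_2}$ is the gain graph on $\{1,2,3\}$ with, for each $1\le i<j\le 3$ and $x\in\mathbb{Z}_2\times\mathbb{Z}_2$, an edge $x_{ij}$ oriented $i\to j$ labelled $x$, and a loop $b_i$ at each vertex. For a subgraph $G$ and distinct $i,j$, $\ell(ij)=\ell(ji)$ is the set of $x$ with $x_{ij}\in E(G)$. $G$ is an $(a,b,c)$-triangle if its vertices can be named $i,j,k$ with $|\ell(ij)|\ge a$, $|\ell(ik)|\ge b$, $|\ell(jk)|\ge c$. A cycle with at least two edges is balanced if the product of its labels is the identity, otherwise unbalanced; loops are unbalanced. The frame matroid $\mathrm{FM}(G)$ has ground set $E(G)$ and circuits the edge sets of: balanced cycles; two unbalanced cycles sharing exactly one vertex; two vertex-disjoint unbalanced cycles joined by a path meeting them only at its ends; theta subgraphs all of whose cycles are unbalanced. $M(K_4)$ is the cycle matroid of $K_4$. -}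

module Defs where

open import Data.Bool using (Bool; true; false; _xor_)
open import Data.Unit using (⊤; tt)
open import Data.Empty using (⊥)
open import Data.Fin using (Fin; _<_)
open import Data.Nat using (ℕ)
open import Data.List using (List; []; _∷_; _++_; length)
open import Data.List.Membership.Propositional using (_∈_; _∉_)
open import Data.List.Relation.Unary.All using (All)
open import Data.List.Relation.Unary.Unique.Propositional using (Unique)
open import Data.Product using (Σ; ∃; _×_; _,_)
open import Data.Sum using (_⊎_)
open import Relation.Binary.PropositionalEquality using (_≡_; _≢_)
open import Relation.Nullary using (¬_)
open import Function.Bundles using (_⇔_)
open import Function.Definitions using (Injective)

Γ : Set
Γ = Bool × Bool

ε : Γ
ε = (false , false)

_·_ : Γ → Γ → Γ
(a , b) · (c , d) = (a xor c , b xor d)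

inv : Γ → Γ        -- every element of Z2×Z2 is its own inverse
inv x = x

-- Generic paths / cycles (of length ≥ 2) in a multigraph given by a
-- "traversal step" relation  Step e u v a : edge e traversed from u to v
-- contributes gain a.

module Walks {V E A : Set} (_∙_ : A → A → A) (e₀ : A)
             (Step : E → V → V → A → Set) where

  data Path : V → V → List V → List E → A → Set where
    nil  : ∀ v → Path v v (v ∷ []) [] e₀
    cons : ∀ {u v w vs es a g} (e : E) → Step e u v a → u ∉ vs →
           Path v w vs es g → Path u w (u ∷ vs) (e ∷ es) (a ∙ g)

  -- Cycle vs es g : cycle with at least two edges, closed by an edge f.
  data Cycle : List V → List E → A → Set where
    close : ∀ {u v vs es g a} (f : E) → Path u v vs es g → u ≢ v →
            Step f v u a → f ∉ es → Cycle vs (f ∷ es) (g ∙ a)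

_≐_ : {E : Set} → (E → Set) → List E → Set
S ≐ es = ∀ e → S e ⇔ e ∈ es

-- The gain graph K_3^{Z2×Z2}; vertices 1,2,3 are Fin 3.

V3 : Set
V3 = Fin 3

data Edge : Set where
  loop : V3 → Edge
  arc  : (i j : V3) → .(i < j) → Γ → Edge

data Step3 : Edge → V3 → V3 → Γ → Set where
  fwd : ∀ {i j x} .{p : i < j} → Step3 (arc i j p x) i j x
  bwd : ∀ {i j x} .{p : i < j} → Step3 (arc i j p x) j i (inv x)

open module W3 = Walks {V3} {Edge} {Γ} _·_ ε Step3 public
  renaming (Path to Path3; Cycle to Cycle3)

data FCycle : List V3 → List Edge → Set where
  loopC : ∀ v → FCycle (v ∷ []) (loop v ∷ [])
  longC : ∀ {vs es g} → Cycle3 vs es g → FCycle vs es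

Balanced : ∀ {vs es} → FCycle vs es → Set
Balanced (loopC v) = ⊥
Balanced (longC {g = g} _) = g ≡ ε

Unbalanced : ∀ {vs es} → FCycle vs es → Set
Unbalanced C = ¬ Balanced C

Disjoint : {A : Set} → List A → List A → Set
Disjoint xs ys = ∀ x → x ∈ xs → x ∉ ys

data FrameCircuit (S : Edge → Set) : Set where
  balancedCycle :
    ∀ {vs es} (C : FCycle vs es) → Balanced C → S ≐ es → FrameCircuit S
  tightHandcuff :
    ∀ {vs₁ es₁ vs₂ es₂} (C₁ : FCycle vs₁ es₁) (C₂ : FCycle vs₂ es₂) →
    Unbalanced C₁ → Unbalanced C₂ →
    Disjoint es₁ es₂ →
    (Σ V3 λ v → v ∈ vs₁ × v ∈ vs₂ × (∀ w → w ∈ vs₁ → w ∈ vs₂ → w ≡ v)) →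
    S ≐ (es₁ ++ es₂) → FrameCircuit S
  looseHandcuff :
    ∀ {vs₁ es₁ vs₂ es₂ u w pvs pes g} (C₁ : FCycle vs₁ es₁) (C₂ : FCycle vs₂ es₂) →
    Unbalanced C₁ → Unbalanced C₂ → Disjoint vs₁ vs₂ →
    Path3 u w pvs pes g → u ∈ vs₁ → w ∈ vs₂ →
    (∀ x → x ∈ pvs → x ∈ vs₁ → x ≡ u) →
    (∀ x → x ∈ pvs → x ∈ vs₂ → x ≡ w) →
    S ≐ (es₁ ++ es₂ ++ pes) → FrameCircuit S
  contraTheta :
    ∀ {u v vs₁ es₁ g₁ vs₂ es₂ g₂ vs₃ es₃ g₃} → u ≢ v →
    Path3 u v vs₁ es₁ g₁ → Path3 u v vs₂ es₂ g₂ → Path3 u v vs₃ es₃ g₃ →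
    (∀ w → w ∈ vs₁ → w ∈ vs₂ → w ≡ u ⊎ w ≡ v) →
    (∀ w → w ∈ vs₁ → w ∈ vs₃ → w ≡ u ⊎ w ≡ v) →
    (∀ w → w ∈ vs₂ → w ∈ vs₃ → w ≡ u ⊎ w ≡ v) →
    Disjoint es₁ es₂ → Disjoint es₁ es₃ → Disjoint es₂ es₃ →
    (∀ {cvs ces} (C : FCycle cvs ces) →
       (∀ e → e ∈ ces → e ∈ (es₁ ++ es₂ ++ es₃)) → Unbalanced C) →
    S ≐ (es₁ ++ es₂ ++ es₃) → FrameCircuit S

-- A subgraph G (spanning all three vertices) is given by its edge set.
Subgraph : Set
Subgraph = Edge → Bool

FMCircuit : Subgraph → (Edge → Set) → Set
FMCircuit G S = (∀ e → S e → G e ≡ true) × FrameCircuit S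

InLabel : Subgraph → V3 → V3 → Γ → Set
InLabel G i j x =
    (Σ (i < j) λ p → G (arc i j p x) ≡ true)
  ⊎ (Σ (j < i) λ p → G (arc j i p x) ≡ true)

LabelsAtLeast : Subgraph → V3 → V3 → ℕ → Set
LabelsAtLeast G i j a =
  Σ (List Γ) λ xs → length xs ≡ a × Unique xs × All (InLabel G i j) xs

IsTriangle : ℕ → ℕ → ℕ → Subgraph → Set
IsTriangle a b c G =
  Σ V3 λ i → Σ V3 λ j → Σ V3 λ k → i ≢ j × i ≢ k × j ≢ k ×
    LabelsAtLeast G i j a × LabelsAtLeast G i k b × LabelsAtLeast G j k c

data E4 : Set where
  kedge : (i j : Fin 4) → .(i < j) → E4

data Step4 : E4 → Fin 4 → Fin 4 → ⊤ → Set where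
  fwd : ∀ {i j} .{p : i < j} → Step4 (kedge i j p) i j tt
  bwd : ∀ {i j} .{p : i < j} → Step4 (kedge i j p) j i tt

open module W4 = Walks {Fin 4} {E4} {⊤} (λ _ _ → tt) tt Step4 public
  renaming (Path to Path4; Cycle to Cycle4)

K4Circuit : (E4 → Set) → Set
K4Circuit T = Σ (List (Fin 4)) λ vs → Σ (List E4) λ es → Cycle4 vs es tt × T ≐ es

-- FM(G) has a submatroid (restriction) isomorphic to M(K_4):
-- an injection φ : E(K_4) → E(G) such that a set T of edges of K_4
-- is a circuit of M(K_4) iff φ(T) is a circuit of FM(G).
HasMK4Submatroid : Subgraph → Set
HasMK4Submatroid G =
  Σ (E4 → Edge) λ φ → Injective _≡_ _≡_ φ × (∀ d → G (φ d) ≡ true) ×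
    (∀ (T : E4 → Bool) →
       K4Circuit (λ d → T d ≡ true) ⇔
       FMCircuit G (λ e → Σ E4 λ d → T d ≡ true × φ d ≡ e))

-- A (4,3,2)-triangle on i, j, k has all labels on ij, two labels e, e·q on jk and, since Γ has
-- only two cosets of ⟨q⟩, a coset {c, c·q} among its three labels on ik. With the vertex
-- potential pot i = c, pot j = e, pot k = ε these give a doubled triangle: each side uv carries
-- the two labels pot u · pot v · q^b (b ∈ {0,1}). Along a path the potentials telescope, so the
-- gain of a cycle is q raised to the number of its copy-1 edges. Hence the balanced cycles are
-- the even transversals, the unbalanced ones the digons and the odd transversals, and the
-- circuits of the frame matroid are the four balanced triangles and the three tight handcuffs
-- made of two digons (loose handcuffs need four vertices; two of the three paths of a theta are
-- parallel edges, and one of them closes the third path into a balanced cycle). These seven sets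
-- are the four triangles and the three 4-cycles of K₄ once the two copies of the side opposite
-- κ are sent to the side of K₃ ⊆ K₄ opposite κ and to the spoke from κ to the fourth vertex.

module Submission where

open import Defs
open import Data.Bool using (Bool; true; false; _xor_)
open import Data.Bool.Properties using (xor-comm; xor-assoc; xor-identityʳ; xor-same) renaming (_≟_ to _≟ᴮ_)
open import Data.Empty using (⊥; ⊥-elim)
open import Data.Fin using (Fin; zero; suc; _<_)
open import Data.Fin.Properties using (_≟_; all?; any?; injective⇒≤; <-cmp; _<?_; <-irrefl; <-asym)
open import Data.List using (List; []; _∷_; _++_; map; length; lookup; foldr)
open import Data.List.Properties using (map-∘; map-cong)
open import Data.List.Membership.Propositional using (_∈_; _∉_)
open import Data.List.Membership.Propositional.Properties using (∈-lookup; ∈-map⁺; ∈-map⁻; ∈-++⁺ˡ; ∈-++⁺ʳ)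
import Data.List.Membership.DecPropositional as MembershipDec
open import Data.List.Relation.Binary.Subset.Propositional using (_⊆_)
open import Data.List.Relation.Binary.Subset.Propositional.Properties using (map⁺; ++⁺; xs⊆xs++ys; xs⊆ys++xs)
import Data.List.Relation.Binary.Subset.DecPropositional as SubsetDec
open import Data.List.Relation.Unary.All as All using (All; []; _∷_)
open import Data.List.Relation.Unary.All.Properties using (¬Any⇒All¬; All¬⇒¬Any)
open import Data.List.Relation.Unary.AllPairs using ([]; _∷_)
open import Data.List.Relation.Unary.Any as Any using (Any; here; there; satisfied)
open import Data.List.Relation.Unary.Unique.Propositional using (Unique)
import Data.List.Relation.Unary.Unique.DecPropositional as UniqueDec
import Data.Nat as ℕ
open import Data.Nat using (_≤_; s≤s; z≤n)
open import Data.Product using (Σ; _×_; _,_; proj₁; proj₂)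
open import Data.Product.Properties using (≡-dec)
open import Data.Sum using (_⊎_; inj₁; inj₂)
open import Data.Unit using (tt)
open import Function using (id; _∘_)
open import Function.Bundles using (_⇔_; mk⇔; Equivalence)
open import Function.Definitions using (Injective)
open import Relation.Binary.Definitions using (DecidableEquality; tri<; tri≈; tri>)
open import Relation.Binary.PropositionalEquality
open import Relation.Nullary using (¬_; contradiction; Dec; yes; no; ¬?; _×-dec_; _⊎-dec_; _→-dec_)
open import Relation.Nullary.Decidable using (map′; from-yes; recompute; True; toWitness)
open import Relation.Unary using (Decidable)

pattern v0 = zero
pattern v1 = suc zero
pattern v2 = suc (suc zero)
pattern v3 = suc (suc (suc zero))

·-comm : ∀ x y → x · y ≡ y · x
·-comm (a , b) (c , d) = cong₂ _,_ (xor-comm a c) (xor-comm b d)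

·-assoc : ∀ x y z → (x · y) · z ≡ x · (y · z)
·-assoc (a , b) (c , d) (e , f) = cong₂ _,_ (xor-assoc a c e) (xor-assoc b d f)

·-identityʳ : ∀ x → x · ε ≡ x
·-identityʳ (a , b) = cong₂ _,_ (xor-identityʳ a) (xor-identityʳ b)

·-self : ∀ x → x · x ≡ ε
·-self (a , b) = cong₂ _,_ (xor-same a) (xor-same b)

·-absorb : ∀ x y → x · (x · y) ≡ y
·-absorb x y = trans (sym (·-assoc x x y)) (cong (_· y) (·-self x))

·-cancelˡ : ∀ x {y z} → x · y ≡ x · z → y ≡ z
·-cancelˡ x {y} {z} xy≡xz = trans (sym (·-absorb x y)) (trans (cong (x ·_) xy≡xz) (·-absorb x z))

·≡ε⇒≡ : ∀ x y → x · y ≡ ε → x ≡ y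
·≡ε⇒≡ x y xy≡ε = sym (·-cancelˡ x (trans xy≡ε (sym (·-self x))))

·-telescope : ∀ x y z → (x · y) · (y · z) ≡ x · z
·-telescope x y z = begin
  (x · y) · (y · z)  ≡⟨ ·-assoc x y (y · z) ⟩
  x · (y · (y · z))  ≡⟨ cong (x ·_) (·-absorb y z) ⟩
  x · z              ∎
  where open ≡-Reasoning

·-interchange : ∀ w x y z → (w · x) · (y · z) ≡ (w · y) · (x · z)
·-interchange w x y z = begin
  (w · x) · (y · z)  ≡⟨ ·-assoc w x (y · z) ⟩
  w · (x · (y · z))  ≡⟨ cong (w ·_) (sym (·-assoc x y z)) ⟩
  w · ((x · y) · z)  ≡⟨ cong (λ t → w · (t · z)) (·-comm x y) ⟩
  w · ((y · x) · z)  ≡⟨ cong (w ·_) (·-assoc y x z) ⟩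
  w · (y · (x · z))  ≡⟨ sym (·-assoc w y (x · z)) ⟩
  (w · y) · (x · z)  ∎
  where open ≡-Reasoning

∀-Bool? : {P : Bool → Set} → Decidable P → Dec (∀ b → P b)
∀-Bool? P? = map′ (λ { (f , t) false → f ; (f , t) true → t }) (λ h → h false , h true) (P? false ×-dec P? true)

∃-Bool? : {P : Bool → Set} → Decidable P → Dec (Σ Bool P)
∃-Bool? P? = map′ (λ { (inj₁ pf) → false , pf ; (inj₂ pt) → true , pt })
                  (λ { (false , pf) → inj₁ pf ; (true , pt) → inj₂ pt }) (P? false ⊎-dec P? true)

_≟Γ_ : DecidableEquality Γ
_≟Γ_ = ≡-dec _≟ᴮ_ _≟ᴮ_

∀-Γ? : {P : Γ → Set} → Decidable P → Dec (∀ x → P x)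
∀-Γ? P? = map′ (λ f (a , b) → f a b) (λ f a b → f (a , b)) (∀-Bool? λ a → ∀-Bool? λ b → P? (a , b))

∃-Γ? : {P : Γ → Set} → Decidable P → Dec (Σ Γ P)
∃-Γ? P? = map′ (λ (a , b , pab) → (a , b) , pab) (λ ((a , b) , pab) → a , b , pab)
               (∃-Bool? λ a → ∃-Bool? λ b → P? (a , b))

bits-cover : ∀ {b₁ b₂ : Bool} → b₁ ≢ b₂ → ∀ c → c ≡ b₁ ⊎ c ≡ b₂
bits-cover {false} {false} b₁≢b₂ _ = contradiction refl b₁≢b₂
bits-cover {false} {true}  _ false = inj₁ refl
bits-cover {false} {true}  _ true  = inj₂ refl
bits-cover {true}  {false} _ false = inj₂ refl
bits-cover {true}  {false} _ true  = inj₁ refl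
bits-cover {true}  {true}  b₁≢b₂ _ = contradiction refl b₁≢b₂

Unique⇒lookup-injective : ∀ {A : Set} {xs : List A} → Unique xs → Injective _≡_ _≡_ (lookup xs)
Unique⇒lookup-injective (_ ∷ _)      {zero}  {zero}  _  = refl
Unique⇒lookup-injective (x∉ ∷ _)     {zero}  {suc j} eq = contradiction eq (All.lookup x∉ (∈-lookup j))
Unique⇒lookup-injective (x∉ ∷ _)     {suc i} {zero}  eq = contradiction (sym eq) (All.lookup x∉ (∈-lookup i))
Unique⇒lookup-injective (_ ∷ unique) {suc i} {suc j} eq = cong suc (Unique⇒lookup-injective unique eq)

Unique⇒length≤ : ∀ {n} {xs : List (Fin n)} → Unique xs → length xs ≤ n
Unique⇒length≤ unique = injective⇒≤ (Unique⇒lookup-injective unique)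

infix 4 _≋_

_≋_ : {A : Set} → List A → List A → Set
xs ≋ ys = xs ⊆ ys × ys ⊆ xs

≋-sym : ∀ {A : Set} {xs ys : List A} → xs ≋ ys → ys ≋ xs
≋-sym (xs⊆ys , ys⊆xs) = ys⊆xs , xs⊆ys

≋-dec : {A : Set} → DecidableEquality A → (xs ys : List A) → Dec (xs ≋ ys)
≋-dec _≟_ xs ys = xs ⊆? ys ×-dec ys ⊆? xs
  where open SubsetDec _≟_ using (_⊆?_)

map-≋ : ∀ {A B : Set} (f : A → B) {xs ys} → xs ≋ ys → map f xs ≋ map f ys
map-≋ f (xs⊆ys , ys⊆xs) = map⁺ f xs⊆ys , map⁺ f ys⊆xs

++-≋ : ∀ {A : Set} {xs xs′ ys ys′ : List A} → xs ≋ xs′ → ys ≋ ys′ → xs ++ ys ≋ xs′ ++ ys′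
++-≋ (xs⊆ , ⊆xs) (ys⊆ , ⊆ys) = ++⁺ xs⊆ ys⊆ , ++⁺ ⊆xs ⊆ys

≐-resp-≋ : ∀ {A : Set} {S : A → Set} {xs ys} → S ≐ xs → xs ≋ ys → S ≐ ys
≐-resp-≋ S≐xs (xs⊆ys , ys⊆xs) a = mk⇔ (xs⊆ys ∘ Equivalence.to (S≐xs a)) (Equivalence.from (S≐xs a) ∘ ys⊆xs)

preimage : ∀ {A B : Set} (f : A → B) {ys} → (∀ y → y ∈ ys → Σ A λ x → f x ≡ y) →
           Σ (List A) λ xs → ys ≡ map f xs
preimage f {[]}     _   = [] , refl
preimage f {y ∷ ys} pre with pre y (here refl) | preimage f (λ y′ y′∈ → pre y′ (there y′∈))
... | x , refl | xs , refl = x ∷ xs , refl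

Image : {A B : Set} → (A → B) → (A → Set) → B → Set
Image {A} f P b = Σ A λ a → P a × f a ≡ b

image-≐ : ∀ {A B : Set} {f : A → B} {P : A → Set} {xs} → Injective _≡_ _≡_ f →
          P ≐ xs ⇔ Image f P ≐ map f xs
image-≐ {f = f} {P} {xs} f-injective = mk⇔ image-to image-from
  where
    image-to : P ≐ xs → Image f P ≐ map f xs
    image-to P≐ b = mk⇔ (λ { (a , Pa , refl) → ∈-map⁺ f (Equivalence.to (P≐ a) Pa) })
                        (λ b∈ → let a , a∈ , b≡ = ∈-map⁻ f b∈ in a , Equivalence.from (P≐ a) a∈ , sym b≡)
    image-from : Image f P ≐ map f xs → P ≐ xs
    image-from I≐ a = mk⇔
      (λ Pa → let a′ , a′∈ , fa≡ = ∈-map⁻ f (Equivalence.to (I≐ (f a)) (a , Pa , refl))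
              in subst (_∈ xs) (sym (f-injective fa≡)) a′∈)
      (λ a∈ → let a′ , Pa′ , fa′≡ = Equivalence.from (I≐ (f a)) (∈-map⁺ f a∈) in subst P (f-injective fa′≡) Pa′)

module _ {V E A : Set} {_∙_ : A → A → A} {e₀ : A} {Step : E → V → V → A → Set} where
  open Walks _∙_ e₀ Step

  path-source : ∀ {u w vs es g} → Path u w vs es g → u ∈ vs
  path-source (nil _)        = here refl
  path-source (cons _ _ _ _) = here refl

  path-target : ∀ {u w vs es g} → Path u w vs es g → w ∈ vs
  path-target (nil _)        = here refl
  path-target (cons _ _ _ P) = there (path-target P)

  path-unique : ∀ {u w vs es g} → Path u w vs es g → Unique vs
  path-unique (nil _)         = [] ∷ []
  path-unique (cons _ _ u∉ P) = ¬Any⇒All¬ _ u∉ ∷ path-unique P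

  path-length : ∀ {u w vs es g} → Path u w vs es g → length vs ≡ ℕ.suc (length es)
  path-length (nil _)        = refl
  path-length (cons _ _ _ P) = cong ℕ.suc (path-length P)

  cycle-two-vertices : ∀ {vs es g} → Cycle vs es g → Σ V λ x → Σ V λ y → x ≢ y × x ∈ vs × y ∈ vs
  cycle-two-vertices (close _ P u≢v _ _) = _ , _ , u≢v , path-source P , path-target P

path-length< : ∀ {n E A _∙_ e₀ Step} → let open Walks {Fin n} {E} {A} _∙_ e₀ Step in
               ∀ {u w vs es g} → Path u w vs es g → length es ℕ.< n
path-length< P = subst (_≤ _) (path-length P) (Unique⇒length≤ (path-unique P))

Distinct : V3 → V3 → V3 → Set
Distinct u v w = u ≢ v × u ≢ w × v ≢ w

distinct-swap : ∀ {u v w} → Distinct u v w → Distinct v u w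
distinct-swap (u≢v , u≢w , v≢w) = ≢-sym u≢v , v≢w , u≢w

distinct-rotate : ∀ {u v w} → Distinct u v w → Distinct v w u
distinct-rotate (u≢v , u≢w , v≢w) = v≢w , ≢-sym u≢v , ≢-sym u≢w

distinct-covers : ∀ {u v w} → Distinct u v w → ∀ t → t ∈ u ∷ v ∷ w ∷ []
distinct-covers {u} {v} {w} (u≢v , u≢w , v≢w) t with t ≟ u | t ≟ v | t ≟ w
... | yes t≡u | _       | _       = here t≡u
... | no _    | yes t≡v | _       = there (here t≡v)
... | no _    | no _    | yes t≡w = there (there (here t≡w))
... | no t≢u  | no t≢v  | no t≢w  with Unique⇒length≤ {xs = t ∷ u ∷ v ∷ w ∷ []}
  ((t≢u ∷ t≢v ∷ t≢w ∷ []) ∷ (u≢v ∷ u≢w ∷ []) ∷ (v≢w ∷ []) ∷ [] ∷ [])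
...   | s≤s (s≤s (s≤s ()))

distinct-third : ∀ {u v w w′} → Distinct u v w → w′ ≢ u → w′ ≢ v → w′ ≡ w
distinct-third uvw w′≢u w′≢v with distinct-covers uvw _
... | here w′≡u                 = contradiction w′≡u w′≢u
... | there (here w′≡v)         = contradiction w′≡v w′≢v
... | there (there (here w′≡w)) = w′≡w

same-pair : ∀ {a b x y κ} → Distinct a b κ → Distinct x y κ → (a ≡ x × b ≡ y) ⊎ (a ≡ y × b ≡ x)
same-pair {a} (a≢b , a≢κ , b≢κ) xyκ with distinct-covers xyκ a
... | here refl                 =
  inj₁ (refl , distinct-third (distinct-swap (distinct-rotate (distinct-rotate xyκ))) (≢-sym a≢b) b≢κ)
... | there (here refl)         = inj₂ (refl , distinct-third (distinct-rotate xyκ) (≢-sym a≢b) b≢κ)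
... | there (there (here a≡κ)) = contradiction a≡κ a≢κ

no-disjoint-vertex-pairs : ∀ {x₁ y₁ x₂ y₂ : V3} → x₁ ≢ y₁ → x₂ ≢ y₂ →
                           x₂ ∉ x₁ ∷ y₁ ∷ [] → y₂ ∉ x₁ ∷ y₁ ∷ [] → ⊥
no-disjoint-vertex-pairs x₁≢y₁ x₂≢y₂ x₂∉ y₂∉ =
  x₂≢y₂ (sym (distinct-third (x₁≢y₁ , (λ eq → x₂∉ (here (sym eq))) , (λ eq → x₂∉ (there (here (sym eq)))))
                             (λ eq → y₂∉ (here eq)) (λ eq → y₂∉ (there (here eq)))))

InternallyDisjoint : V3 → V3 → List V3 → List V3 → Set
InternallyDisjoint u v xs ys = ∀ w → w ∈ xs → w ∈ ys → w ≡ u ⊎ w ≡ v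

two-step-paths-meet : ∀ {u v w₁ w₂} → u ≢ v → w₁ ≢ u → w₁ ≢ v → w₂ ≢ u → w₂ ≢ v →
                      ¬ InternallyDisjoint u v (u ∷ w₁ ∷ v ∷ []) (u ∷ w₂ ∷ v ∷ [])
two-step-paths-meet u≢v w₁≢u w₁≢v w₂≢u w₂≢v disjoint
  with disjoint _ (there (here refl)) (there (here (distinct-third (u≢v , ≢-sym w₂≢u , ≢-sym w₂≢v) w₁≢u w₁≢v)))
... | inj₁ w₁≡u = w₁≢u w₁≡u
... | inj₂ w₁≡v = w₁≢v w₁≡v

lo hi : V3 → V3
lo v0 = v1
lo v1 = v0
lo v2 = v0
hi v0 = v2
hi v1 = v2
hi v2 = v1

lo<hi : ∀ κ → lo κ < hi κ
lo<hi v0 = s≤s (s≤s z≤n)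
lo<hi v1 = s≤s z≤n
lo<hi v2 = s≤s z≤n

ends-distinct : ∀ κ → Distinct (lo κ) (hi κ) κ
ends-distinct v0 = (λ ()) , (λ ()) , (λ ())
ends-distinct v1 = (λ ()) , (λ ()) , (λ ())
ends-distinct v2 = (λ ()) , (λ ()) , (λ ())

ends-injective : ∀ {κ κ′} → lo κ ≡ lo κ′ → hi κ ≡ hi κ′ → κ ≡ κ′
ends-injective {v0} {v0} _ _ = refl
ends-injective {v0} {v1} () _
ends-injective {v0} {v2} () _
ends-injective {v1} {v0} () _
ends-injective {v1} {v1} _ _ = refl
ends-injective {v1} {v2} _ ()
ends-injective {v2} {v0} () _
ends-injective {v2} {v1} _ ()
ends-injective {v2} {v2} _ _ = refl

ends-cover : ∀ {κ κ′} → κ′ ≢ κ → κ′ ∈ lo κ ∷ hi κ ∷ []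
ends-cover {κ} {κ′} κ′≢κ with distinct-covers (ends-distinct κ) κ′
... | here κ′≡lo                 = here κ′≡lo
... | there (here κ′≡hi)         = there (here κ′≡hi)
... | there (there (here κ′≡κ)) = contradiction κ′≡κ κ′≢κ

ends-avoid : ∀ {κ w} → w ∈ lo κ ∷ hi κ ∷ [] → w ≢ κ
ends-avoid {κ} (here refl)         = proj₁ (proj₂ (ends-distinct κ))
ends-avoid {κ} (there (here refl)) = proj₂ (proj₂ (ends-distinct κ))

-- The six edges and the seven circuits

-- (κ , b) is copy b of the side lo κ – hi κ of K₃, the side opposite κ.
E6 : Set
E6 = V3 × Bool

parity : List E6 → Bool
parity = foldr (λ d b → proj₂ d xor b) false

digon : V3 → List E6
digon κ = (κ , true) ∷ (κ , false) ∷ []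

-- The seven common circuits: the even transversals (triangles of K₄) and the unions of two
-- digons (4-cycles of K₄).
data Shape : Set where
  triangle : Bool → Bool → Shape
  square   : V3 → Shape

shapeEdges : Shape → List E6
shapeEdges (triangle x y) = (v2 , x xor y) ∷ (v0 , x) ∷ (v1 , y) ∷ []
shapeEdges (square κ)     = digon (lo κ) ++ digon (hi κ)

allShapes : List Shape
allShapes = triangle false false ∷ triangle false true ∷ triangle true false ∷ triangle true true
          ∷ square v0 ∷ square v1 ∷ square v2 ∷ []

_≟E6_ : DecidableEquality E6
_≟E6_ = ≡-dec _≟_ _≟ᴮ_

distinct? : ∀ u v w → Dec (Distinct u v w)
distinct? u v w = ¬? (u ≟ v) ×-dec ¬? (u ≟ w) ×-dec ¬? (v ≟ w)

IsShape : List E6 → Set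
IsShape ds = Any (λ s → ds ≋ shapeEdges s) allShapes

isShape? : ∀ ds → Dec (IsShape ds)
isShape? ds = Any.any? (λ s → ≋-dec _≟E6_ ds (shapeEdges s)) allShapes

opaque
  even-triangle-shape : ∀ u w v x y z → Distinct u w v → parity ((w , z) ∷ (v , x) ∷ (u , y) ∷ []) ≡ false →
                        IsShape ((w , z) ∷ (v , x) ∷ (u , y) ∷ [])
  even-triangle-shape = from-yes (all? λ u → all? λ w → all? λ v → ∀-Bool? λ x → ∀-Bool? λ y → ∀-Bool? λ z →
    distinct? u w v →-dec parity ((w , z) ∷ (v , x) ∷ (u , y) ∷ []) ≟ᴮ false →-dec
    isShape? ((w , z) ∷ (v , x) ∷ (u , y) ∷ []))

  two-digons-shape : ∀ κ₁ κ₂ → κ₁ ≢ κ₂ → IsShape (digon κ₁ ++ digon κ₂)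
  two-digons-shape = from-yes (all? λ κ₁ → all? λ κ₂ → ¬? (κ₁ ≟ κ₂) →-dec isShape? (digon κ₁ ++ digon κ₂))

digon-≋ : ∀ {κ b b′} → b ≢ b′ → (κ , b′) ∷ (κ , b) ∷ [] ≋ digon κ
digon-≋ {b = false} {false} b≢b′ = contradiction refl b≢b′
digon-≋ {b = false} {true}  _    = id , id
digon-≋ {b = true}  {false} _    = swap , swap
  where
    swap : ∀ {A : Set} {x y : A} → x ∷ y ∷ [] ⊆ y ∷ x ∷ []
    swap (here refl)         = there (here refl)
    swap (there (here refl)) = here refl
digon-≋ {b = true}  {true}  b≢b′ = contradiction refl b≢b′

digon-parity : ∀ {κ b b′} → b ≢ b′ → parity ((κ , b′) ∷ (κ , b) ∷ []) ≡ true
digon-parity {b = false} {false} b≢b′ = contradiction refl b≢b′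
digon-parity {b = false} {true}  _    = refl
digon-parity {b = true}  {false} _    = refl
digon-parity {b = true}  {true}  b≢b′ = contradiction refl b≢b′

-- The cycle matroid of K₄

toE4 : E6 → E4
toE4 (v0 , false) = kedge v1 v2 (s≤s (s≤s z≤n))
toE4 (v1 , false) = kedge v0 v2 (s≤s z≤n)
toE4 (v2 , false) = kedge v0 v1 (s≤s z≤n)
toE4 (v0 , true)  = kedge v0 v3 (s≤s z≤n)
toE4 (v1 , true)  = kedge v1 v3 (s≤s (s≤s z≤n))
toE4 (v2 , true)  = kedge v2 v3 (s≤s (s≤s (s≤s z≤n)))

ends4 : E4 → Fin 4 × Fin 4
ends4 (kedge i j _) = i , j

ends4-injective : ∀ {e e′} → ends4 e ≡ ends4 e′ → e ≡ e′
ends4-injective {kedge _ _ _} {kedge _ _ _} refl = refl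

_≟E4_ : DecidableEquality E4
e ≟E4 e′ = map′ ends4-injective (cong ends4) (≡-dec _≟_ _≟_ (ends4 e) (ends4 e′))

opaque
  edges4-covered : ∀ i j → i < j → Σ V3 λ κ → Σ Bool λ b → ends4 (toE4 (κ , b)) ≡ (i , j)
  edges4-covered = from-yes (all? λ i → all? λ j → i <? j →-dec
    any? λ κ → ∃-Bool? λ b → ≡-dec _≟_ _≟_ (ends4 (toE4 (κ , b))) (i , j))

  toE4-injective : Injective _≡_ _≡_ toE4
  toE4-injective {κ , b} {κ′ , b′} = separated κ b κ′ b′
    where
      separated : ∀ κ b κ′ b′ → toE4 (κ , b) ≡ toE4 (κ′ , b′) → (κ , b) ≡ (κ′ , b′)
      separated = from-yes (all? λ κ → ∀-Bool? λ b → all? λ κ′ → ∀-Bool? λ b′ →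
        toE4 (κ , b) ≟E4 toE4 (κ′ , b′) →-dec (κ , b) ≟E6 (κ′ , b′))

toE4-surjective : ∀ e → Σ E6 λ d → toE4 d ≡ e
toE4-surjective (kedge i j i<j) with edges4-covered i j (recompute (i <? j) i<j)
... | κ , b , ends≡ = (κ , b) , ends4-injective ends≡

-- edge4 u u is a junk value.
edge4 : Fin 4 → Fin 4 → E4
edge4 u v with <-cmp u v
... | tri< u<v _ _ = kedge u v u<v
... | tri≈ _ _ _   = kedge v0 v1 (s≤s z≤n)
... | tri> _ _ v<u = kedge v u v<u

step4-edge : ∀ {e u v} → Step4 e u v tt → e ≡ edge4 u v
step4-edge (fwd {i} {j} {i<j}) with <-cmp i j
... | tri< _ _ _   = refl
... | tri≈ i≮j _ _ = contradiction (recompute (i <? j) i<j) i≮j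
... | tri> i≮j _ _ = contradiction (recompute (i <? j) i<j) i≮j
step4-edge (bwd {i} {j} {i<j}) with <-cmp j i
... | tri< j<i _ _ = contradiction j<i (<-asym (recompute (i <? j) i<j))
... | tri≈ _ j≡i _ = contradiction (recompute (i <? j) i<j) (<-irrefl (sym j≡i))
... | tri> _ _ _   = refl

edge4-step : ∀ {u v} → u ≢ v → Step4 (edge4 u v) u v tt
edge4-step {u} {v} u≢v with <-cmp u v
... | tri< _ _ _   = fwd
... | tri≈ _ u≡v _ = contradiction u≡v u≢v
... | tri> _ _ _   = bwd

pathEdges : List (Fin 4) → List E4
pathEdges (a ∷ b ∷ vs) = edge4 a b ∷ pathEdges (b ∷ vs)
pathEdges _            = []

path4-edges : ∀ {u w vs es g} → Path4 u w vs es g → es ≡ pathEdges vs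
path4-edges (nil _)                        = refl
path4-edges (cons _ st _ P@(nil _))        = cong₂ _∷_ (step4-edge st) (path4-edges P)
path4-edges (cons _ st _ P@(cons _ _ _ _)) = cong₂ _∷_ (step4-edge st) (path4-edges P)

IsK4Shape : List E4 → Set
IsK4Shape es = Any (λ s → es ≋ map toE4 (shapeEdges s)) allShapes

isK4Shape? : ∀ es → Dec (IsK4Shape es)
isK4Shape? es = Any.any? (λ s → ≋-dec _≟E4_ es (map toE4 (shapeEdges s))) allShapes

opaque
  edge4-comm : ∀ a b → a ≢ b → edge4 b a ≡ edge4 a b
  edge4-comm = from-yes (all? λ a → all? λ b → ¬? (a ≟ b) →-dec edge4 b a ≟E4 edge4 a b)

  triangle4-shape : ∀ a b c → Unique (a ∷ b ∷ c ∷ []) → IsK4Shape (edge4 c a ∷ pathEdges (a ∷ b ∷ c ∷ []))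
  triangle4-shape = from-yes (all? λ a → all? λ b → all? λ c →
    unique? (a ∷ b ∷ c ∷ []) →-dec isK4Shape? (edge4 c a ∷ pathEdges (a ∷ b ∷ c ∷ [])))
    where open UniqueDec (_≟_ {4}) using (unique?)

  square4-shape : ∀ a b c d → Unique (a ∷ b ∷ c ∷ d ∷ []) →
                  IsK4Shape (edge4 d a ∷ pathEdges (a ∷ b ∷ c ∷ d ∷ []))
  square4-shape = from-yes (all? λ a → all? λ b → all? λ c → all? λ d →
    unique? (a ∷ b ∷ c ∷ d ∷ []) →-dec isK4Shape? (edge4 d a ∷ pathEdges (a ∷ b ∷ c ∷ d ∷ [])))
    where open UniqueDec (_≟_ {4}) using (unique?)

closed-path-shape : ∀ {u v vs es g} → Path4 u v vs es g → u ≢ v → edge4 v u ∉ pathEdges vs →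
                    IsK4Shape (edge4 v u ∷ pathEdges vs)
closed-path-shape (nil _) u≢u _ = contradiction refl u≢u
closed-path-shape (cons _ _ _ (nil _)) u≢v closing∉ = contradiction (here (edge4-comm _ _ u≢v)) closing∉
closed-path-shape P@(cons _ _ _ (cons _ _ _ (nil _))) _ _ = triangle4-shape _ _ _ (path-unique P)
closed-path-shape P@(cons _ _ _ (cons _ _ _ (cons _ _ _ (nil _)))) _ _ = square4-shape _ _ _ _ (path-unique P)
closed-path-shape P@(cons _ _ _ (cons _ _ _ (cons _ _ _ (cons _ _ _ _)))) _ _ with path-length< P
... | s≤s (s≤s (s≤s (s≤s ())))

k4-cycle-shape : ∀ {vs es} → Cycle4 vs es tt → IsK4Shape es
k4-cycle-shape (close _ P u≢v st closing∉) with step4-edge st | path4-edges P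
... | refl | refl = closed-path-shape P u≢v closing∉

final : Fin 4 → List (Fin 4) → Fin 4
final u []       = u
final _ (v ∷ vs) = final v vs

closingEdge : Fin 4 → List (Fin 4) → E4
closingEdge u vs = edge4 (final u vs) u

path4-through : ∀ u vs → Unique (u ∷ vs) → Path4 u (final u vs) (u ∷ vs) (pathEdges (u ∷ vs)) tt
path4-through u []       _             = W4.nil u
path4-through u (v ∷ vs) (u∉ ∷ unique) =
  W4.cons (edge4 u v) (edge4-step (All.head u∉)) (All¬⇒¬Any u∉) (path4-through v vs unique)

Tour : Fin 4 → List (Fin 4) → Set
Tour u vs = Unique (u ∷ vs) × u ≢ final u vs × closingEdge u vs ∉ pathEdges (u ∷ vs)

tour-cycle : ∀ {u vs} → Tour u vs → Cycle4 (u ∷ vs) (closingEdge u vs ∷ pathEdges (u ∷ vs)) tt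
tour-cycle {u} {vs} (unique , u≢final , closing∉) =
  W4.close (closingEdge u vs) (path4-through u vs unique) u≢final (edge4-step (≢-sym u≢final)) closing∉

TourOf : Shape → Fin 4 → List (Fin 4) → Set
TourOf s u vs = Tour u vs × closingEdge u vs ∷ pathEdges (u ∷ vs) ≋ map toE4 (shapeEdges s)

tourOf? : ∀ s u vs → Dec (TourOf s u vs)
tourOf? s u vs = (unique? (u ∷ vs) ×-dec ¬? (u ≟ final u vs) ×-dec ¬? (closingEdge u vs ∈? pathEdges (u ∷ vs)))
          ×-dec ≋-dec _≟E4_ (closingEdge u vs ∷ pathEdges (u ∷ vs)) (map toE4 (shapeEdges s))
  where open MembershipDec _≟E4_ using (_∈?_)
        open UniqueDec (_≟_ {4}) using (unique?)

ShapeTour : Shape → Set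
ShapeTour s = Σ (Fin 4) λ u → Σ (List (Fin 4)) (TourOf s u)

tour-through : ∀ s u vs → {True (tourOf? s u vs)} → ShapeTour s
tour-through s u vs {found} = u , vs , toWitness found

shape-tour : ∀ s → ShapeTour s
shape-tour (triangle false false) = tour-through (triangle false false) v0 (v1 ∷ v2 ∷ [])
shape-tour (triangle false true)  = tour-through (triangle false true)  v1 (v2 ∷ v3 ∷ [])
shape-tour (triangle true  false) = tour-through (triangle true  false) v0 (v2 ∷ v3 ∷ [])
shape-tour (triangle true  true)  = tour-through (triangle true  true)  v0 (v1 ∷ v3 ∷ [])
shape-tour (square v0)            = tour-through (square v0)            v0 (v1 ∷ v3 ∷ v2 ∷ [])
shape-tour (square v1)            = tour-through (square v1)            v0 (v1 ∷ v2 ∷ v3 ∷ [])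
shape-tour (square v2)            = tour-through (square v2)            v0 (v2 ∷ v1 ∷ v3 ∷ [])

k4-circuit⇔shape : ∀ {T} → K4Circuit T ⇔ (Σ Shape λ s → T ≐ map toE4 (shapeEdges s))
k4-circuit⇔shape = mk⇔
  (λ (_ , _ , C , T≐) → let s , ≋s = satisfied (k4-cycle-shape C) in s , ≐-resp-≋ T≐ ≋s)
  (λ (s , T≐) → let u , vs , tour , ≋s = shape-tour s in
                u ∷ vs , _ , tour-cycle tour , ≐-resp-≋ T≐ (≋-sym ≋s))

-- The doubled triangle

arc-injective : ∀ {i j i′ j′ x x′} .{i<j : i < j} .{i′<j′ : i′ < j′} →
                arc i j i<j x ≡ arc i′ j′ i′<j′ x′ → i ≡ i′ × j ≡ j′ × x ≡ x′
arc-injective refl = refl , refl , refl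

module DoubledTriangle (pot : V3 → Γ) (p : Γ) (p≢ε : p ≢ ε) where

  bit : Bool → Γ
  bit false = ε
  bit true  = p

  bit-xor : ∀ x y → bit (x xor y) ≡ bit x · bit y
  bit-xor false y     = refl
  bit-xor true  false = sym (·-identityʳ p)
  bit-xor true  true  = sym (·-self p)

  bit≡ε : ∀ {x} → bit x ≡ ε → x ≡ false
  bit≡ε {false} _   = refl
  bit≡ε {true}  p≡ε = contradiction p≡ε p≢ε

  bit-injective : ∀ {b b′} → bit b ≡ bit b′ → b ≡ b′
  bit-injective {false} {false} _   = refl
  bit-injective {false} {true}  ε≡p = contradiction (sym ε≡p) p≢ε
  bit-injective {true}  {false} p≡ε = contradiction p≡ε p≢ε
  bit-injective {true}  {true}  _   = refl

  gainVia : V3 → Bool → V3 → Γ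
  gainVia u b v = (pot u · pot v) · bit b

  gainVia-sym : ∀ u b v → gainVia u b v ≡ gainVia v b u
  gainVia-sym u b v = cong (_· bit b) (·-comm (pot u) (pot v))

  gainVia-concat : ∀ u b v c w → gainVia u b v · gainVia v c w ≡ gainVia u (b xor c) w
  gainVia-concat u b v c w = begin
    ((pot u · pot v) · bit b) · ((pot v · pot w) · bit c)
      ≡⟨ ·-interchange (pot u · pot v) (bit b) (pot v · pot w) (bit c) ⟩
    ((pot u · pot v) · (pot v · pot w)) · (bit b · bit c)
      ≡⟨ cong₂ _·_ (·-telescope (pot u) (pot v) (pot w)) (sym (bit-xor b c)) ⟩
    (pot u · pot w) · bit (b xor c)
      ∎
    where open ≡-Reasoning

  -- Opaque so that ψ (κ , b) is not η-expanded through the gain, which would hide κ and b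
  -- from unification.
  opaque
    ψ : E6 → Edge
    ψ (κ , b) = arc (lo κ) (hi κ) (lo<hi κ) (gainVia (lo κ) b (hi κ))

  opaque
    unfolding ψ

    ψ-arc : ∀ κ b → ψ (κ , b) ≡ arc (lo κ) (hi κ) (lo<hi κ) (gainVia (lo κ) b (hi κ))
    ψ-arc _ _ = refl

    ψ-injective : Injective _≡_ _≡_ ψ
    ψ-injective {κ , b} {κ′ , b′} eq with arc-injective eq
    ... | lo≡ , hi≡ , gain≡ with ends-injective lo≡ hi≡
    ... | refl = cong (κ ,_) (bit-injective (·-cancelˡ (pot (lo κ) · pot (hi κ)) gain≡))

    ψ≢loop : ∀ d v → ψ d ≢ loop v
    ψ≢loop _ _ ()

    ψ-step : ∀ {κ b u v a} → Step3 (ψ (κ , b)) u v a → Distinct u v κ × a ≡ gainVia u b v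
    ψ-step {κ}     fwd = ends-distinct κ , refl
    ψ-step {κ} {b} bwd = distinct-swap (ends-distinct κ) , gainVia-sym (lo κ) b (hi κ)

    ψ-joins : ∀ {κ u v} b → Distinct u v κ → Step3 (ψ (κ , b)) u v (gainVia u b v)
    ψ-joins {κ} {u} {v} b (u≢v , u≢κ , v≢κ) with distinct-covers (ends-distinct κ) u
    ... | here refl =
      from-lo (distinct-third (distinct-swap (distinct-rotate (distinct-rotate (ends-distinct κ)))) (≢-sym u≢v) v≢κ)
      where
        from-lo : v ≡ hi κ → Step3 (ψ (κ , b)) u v (gainVia u b v)
        from-lo refl = fwd
    ... | there (here refl) = from-hi (distinct-third (distinct-rotate (ends-distinct κ)) (≢-sym u≢v) v≢κ)
      where
        from-hi : v ≡ lo κ → Step3 (ψ (κ , b)) u v (gainVia u b v)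
        from-hi refl = subst (Step3 (ψ (κ , b)) u v) (gainVia-sym v b u) bwd
    ... | there (there (here u≡κ)) = contradiction u≡κ u≢κ

  path-gain : ∀ {u w vs ds g} → Path3 u w vs (map ψ ds) g → g ≡ gainVia u (parity ds) w
  path-gain {u} {ds = []} (nil _) = sym (trans (·-identityʳ (pot u · pot u)) (·-self (pot u)))
  path-gain {u} {ds = (κ , b) ∷ ds} (cons {v = v} {w = w} _ st _ P) =
    trans (cong₂ _·_ (proj₂ (ψ-step st)) (path-gain P)) (gainVia-concat u b v (parity ds) w)

  cycle-gain : ∀ {vs ds g} → Cycle3 vs (map ψ ds) g → g ≡ bit (parity ds)
  cycle-gain {ds = (κ , b) ∷ ds} (close {u} {v} {g = g} {a} _ P _ st _) = begin
    g · a                                     ≡⟨ cong₂ _·_ (path-gain P) (proj₂ (ψ-step st)) ⟩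
    gainVia u (parity ds) v · gainVia v b u   ≡⟨ gainVia-concat u (parity ds) v b u ⟩
    (pot u · pot u) · bit (parity ds xor b)   ≡⟨ cong₂ _·_ (·-self (pot u)) (cong bit (xor-comm (parity ds) b)) ⟩
    bit (b xor parity ds)                     ∎
    where open ≡-Reasoning

  data CycleShape : List V3 → List E6 → Set where
    digon-cycle    : ∀ {vs κ b b′} → b ≢ b′ → CycleShape vs ((κ , b′) ∷ (κ , b) ∷ [])
    triangle-cycle : ∀ {u w v x y z} → Distinct u w v →
                     CycleShape (u ∷ w ∷ v ∷ []) ((w , z) ∷ (v , x) ∷ (u , y) ∷ [])

  cycle-shape : ∀ {vs ds g} → Cycle3 vs (map ψ ds) g → CycleShape vs ds
  cycle-shape {ds = _ ∷ []} (close _ (nil _) u≢u _ _) = contradiction refl u≢u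
  cycle-shape {ds = _ ∷ _ ∷ []} (close _ (cons _ st₁ _ (nil _)) _ st closing∉)
    with ψ-step st₁ | ψ-step st
  ... | uvκ₁@(_ , u≢κ₁ , v≢κ₁) , _ | (_ , v≢κ , u≢κ) , _
    with distinct-third uvκ₁ (≢-sym u≢κ) (≢-sym v≢κ)
  ... | refl = digon-cycle (λ { refl → closing∉ (here refl) })
  cycle-shape {ds = _ ∷ _ ∷ _ ∷ []} (close _ (cons _ st₁ _ (cons _ st₂ _ (nil _))) u≢v st _)
    with ψ-step st₁ | ψ-step st₂ | ψ-step st
  ... | (u≢w , u≢κ₁ , w≢κ₁) , _ | (w≢v , w≢κ₂ , v≢κ₂) , _ | (_ , v≢κ , u≢κ) , _
    with distinct-third (u≢w , u≢v , w≢v) (≢-sym u≢κ₁) (≢-sym w≢κ₁)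
       | distinct-third (distinct-rotate (u≢w , u≢v , w≢v)) (≢-sym w≢κ₂) (≢-sym v≢κ₂)
       | distinct-third (distinct-rotate (distinct-rotate (u≢w , u≢v , w≢v))) (≢-sym v≢κ) (≢-sym u≢κ)
  ... | refl | refl | refl = triangle-cycle (u≢w , u≢v , w≢v)
  cycle-shape {ds = _ ∷ _ ∷ _ ∷ _ ∷ _} (close _ P _ _ _) with path-length< P
  ... | s≤s (s≤s (s≤s ()))

  data ShortPath (u v : V3) : List V3 → List E6 → Set where
    direct : ∀ {κ b} → Distinct u v κ → ShortPath u v (u ∷ v ∷ []) ((κ , b) ∷ [])
    via    : ∀ {w d₁ d₂} → w ≢ u → w ≢ v → ShortPath u v (u ∷ w ∷ v ∷ []) (d₁ ∷ d₂ ∷ [])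

  short-path : ∀ {u v vs ds g} → u ≢ v → Path3 u v vs (map ψ ds) g → ShortPath u v vs ds
  short-path {ds = []} u≢u (nil _) = contradiction refl u≢u
  short-path {ds = _ ∷ []} _ (cons _ st _ (nil _)) = direct (proj₁ (ψ-step st))
  short-path {ds = _ ∷ _ ∷ []} _ (cons _ st₁ _ (cons _ st₂ _ (nil _)))
    with ψ-step st₁ | ψ-step st₂
  ... | (u≢w , _) , _ | (w≢v , _) , _ = via (≢-sym u≢w) w≢v
  short-path {ds = _ ∷ _ ∷ _ ∷ _} _ P with path-length< P
  ... | s≤s (s≤s (s≤s ()))

  balanced-closure : ∀ {u v vs ds g κ} → u ≢ v → Distinct u v κ → Path3 u v vs (map ψ ds) g →
                     ψ (κ , parity ds) ∉ map ψ ds → Σ (FCycle vs (ψ (κ , parity ds) ∷ map ψ ds)) Balanced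
  balanced-closure {ds = ds} {κ = κ} u≢v uvκ P closing∉ =
    longC C , trans (cycle-gain C) (cong bit (xor-same (parity ds)))
    where
      C = W3.close (ψ (κ , parity ds)) P u≢v (ψ-joins (parity ds) (distinct-swap uvκ)) closing∉

  UnbalancedWithin : List Edge → Set
  UnbalancedWithin U = ∀ {cvs ces} (C : FCycle cvs ces) → (∀ e → e ∈ ces → e ∈ U) → Unbalanced C

  parallel-pair-balanced : ∀ {U u v κ₁ κ₂ b₁ b₂ vs ds g} → u ≢ v → Distinct u v κ₁ → Distinct u v κ₂ →
    ψ (κ₁ , b₁) ≢ ψ (κ₂ , b₂) → Path3 u v vs (map ψ ds) g →
    ψ (κ₁ , b₁) ∉ map ψ ds → ψ (κ₂ , b₂) ∉ map ψ ds → ψ (κ₁ , b₁) ∈ U → ψ (κ₂ , b₂) ∈ U →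
    (∀ e → e ∈ map ψ ds → e ∈ U) → ¬ UnbalancedWithin U
  parallel-pair-balanced {U} {κ₁ = κ} {b₁ = b₁} {b₂} {ds = ds}
    u≢v uvκ (_ , u≢κ₂ , v≢κ₂) ψ₁≢ψ₂ P ψ₁∉ ψ₂∉ ψ₁∈U ψ₂∈U ds⊆U unbalanced
    with distinct-third uvκ (≢-sym u≢κ₂) (≢-sym v≢κ₂)
  ... | refl with closing-edge (bits-cover (ψ₁≢ψ₂ ∘ cong (λ b → ψ (κ , b))) (parity ds))
    where
      closing-edge : parity ds ≡ b₁ ⊎ parity ds ≡ b₂ → ψ (κ , parity ds) ∉ map ψ ds × ψ (κ , parity ds) ∈ U
      closing-edge (inj₁ refl) = ψ₁∉ , ψ₁∈U
      closing-edge (inj₂ refl) = ψ₂∉ , ψ₂∈U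
  ... | closing∉ , closing∈U with balanced-closure u≢v uvκ P closing∉
  ...   | C , balanced = unbalanced C (λ { _ (here refl) → closing∈U ; e (there e∈) → ds⊆U e e∈ }) balanced

  no-three-parallel : ∀ {u v κ₁ κ₂ κ₃ b₁ b₂ b₃} → Distinct u v κ₁ → Distinct u v κ₂ → Distinct u v κ₃ →
    ψ (κ₁ , b₁) ≢ ψ (κ₂ , b₂) → ψ (κ₁ , b₁) ≢ ψ (κ₃ , b₃) → ψ (κ₂ , b₂) ≢ ψ (κ₃ , b₃) → ⊥
  no-three-parallel {b₁ = b₁} {b₂} {b₃} uvκ (_ , u≢κ₂ , v≢κ₂) (_ , u≢κ₃ , v≢κ₃) ψ₁≢ψ₂ ψ₁≢ψ₃ ψ₂≢ψ₃
    with distinct-third uvκ (≢-sym u≢κ₂) (≢-sym v≢κ₂) | distinct-third uvκ (≢-sym u≢κ₃) (≢-sym v≢κ₃)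
  ... | refl | refl with bits-cover {b₁} {b₂} (λ { refl → ψ₁≢ψ₂ refl }) b₃
  ... | inj₁ refl = ψ₁≢ψ₃ refl
  ... | inj₂ refl = ψ₂≢ψ₃ refl

  no-unbalanced-theta : ∀ {u v vs₁ ds₁ g₁ vs₂ ds₂ g₂ vs₃ ds₃ g₃} → u ≢ v →
    Path3 u v vs₁ (map ψ ds₁) g₁ → Path3 u v vs₂ (map ψ ds₂) g₂ → Path3 u v vs₃ (map ψ ds₃) g₃ →
    InternallyDisjoint u v vs₁ vs₂ → InternallyDisjoint u v vs₁ vs₃ → InternallyDisjoint u v vs₂ vs₃ →
    Disjoint (map ψ ds₁) (map ψ ds₂) → Disjoint (map ψ ds₁) (map ψ ds₃) → Disjoint (map ψ ds₂) (map ψ ds₃) →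
    ¬ UnbalancedWithin (map ψ ds₁ ++ map ψ ds₂ ++ map ψ ds₃)
  no-unbalanced-theta {ds₁ = ds₁} {ds₂ = ds₂} u≢v P₁ P₂ P₃ i₁₂ i₁₃ i₂₃ dj₁₂ dj₁₃ dj₂₃
    with short-path u≢v P₁ | short-path u≢v P₂ | short-path u≢v P₃
  ... | via w₁≢u w₁≢v | via w₂≢u w₂≢v | _ = λ _ → two-step-paths-meet u≢v w₁≢u w₁≢v w₂≢u w₂≢v i₁₂
  ... | via w₁≢u w₁≢v | _ | via w₃≢u w₃≢v = λ _ → two-step-paths-meet u≢v w₁≢u w₁≢v w₃≢u w₃≢v i₁₃
  ... | _ | via w₂≢u w₂≢v | via w₃≢u w₃≢v = λ _ → two-step-paths-meet u≢v w₂≢u w₂≢v w₃≢u w₃≢v i₂₃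
  ... | direct Δ₁ | direct Δ₂ | direct Δ₃ = λ _ →
    no-three-parallel Δ₁ Δ₂ Δ₃ (λ eq → dj₁₂ _ (here refl) (here eq))
      (λ eq → dj₁₃ _ (here refl) (here eq)) (λ eq → dj₂₃ _ (here refl) (here eq))
  ... | direct Δ₁ | direct Δ₂ | via _ _ =
    parallel-pair-balanced u≢v Δ₁ Δ₂ (λ eq → dj₁₂ _ (here refl) (here eq)) P₃
      (dj₁₃ _ (here refl)) (dj₂₃ _ (here refl))
      (here refl) (there (here refl)) (λ _ e∈ → there (there e∈))
  ... | direct Δ₁ | via _ _ | direct Δ₃ =
    parallel-pair-balanced u≢v Δ₁ Δ₃ (λ eq → dj₁₃ _ (here refl) (here eq)) P₂
      (dj₁₂ _ (here refl)) (λ e∈ → dj₂₃ _ e∈ (here refl))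
      (here refl) (there (∈-++⁺ʳ (map ψ ds₂) (here refl))) (λ _ e∈ → there (∈-++⁺ˡ e∈))
  ... | via _ _ | direct Δ₂ | direct Δ₃ =
    parallel-pair-balanced u≢v Δ₂ Δ₃ (λ eq → dj₂₃ _ (here refl) (here eq)) P₁
      (λ e∈ → dj₁₂ _ e∈ (here refl)) (λ e∈ → dj₁₃ _ e∈ (here refl))
      (∈-++⁺ʳ (map ψ ds₁) (here refl)) (∈-++⁺ʳ (map ψ ds₁) (there (here refl))) (λ _ e∈ → ∈-++⁺ˡ e∈)

  digon-unbalanced : ∀ κ → Σ (FCycle (lo κ ∷ hi κ ∷ []) (map ψ (digon κ))) Unbalanced
  digon-unbalanced κ = longC C , λ g≡ε → p≢ε (trans (sym (cycle-gain C)) g≡ε)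
    where
      lo≢hi = proj₁ (ends-distinct κ)
      C = W3.close (ψ (κ , true))
            (W3.cons (ψ (κ , false)) (ψ-joins false (ends-distinct κ)) (λ { (here eq) → lo≢hi eq }) (W3.nil (hi κ)))
            lo≢hi (ψ-joins true (distinct-swap (ends-distinct κ)))
            (λ { (here eq) → contradiction (cong proj₂ (ψ-injective eq)) (λ ()) })

  triangle-balanced : ∀ {u w v} → Distinct u w v → ∀ x y →
    Σ (FCycle (u ∷ w ∷ v ∷ []) (map ψ ((w , x xor y) ∷ (v , x) ∷ (u , y) ∷ []))) Balanced
  triangle-balanced {u} {w} {v} uwv@(u≢w , u≢v , w≢v) x y =
    longC C , trans (cycle-gain C) (cong bit (even x y))
    where
      even : ∀ x y → parity ((w , x xor y) ∷ (v , x) ∷ (u , y) ∷ []) ≡ false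
      even false false = refl
      even false true  = refl
      even true  false = refl
      even true  true  = refl
      other-side : ∀ {κ κ′ b b′} → κ ≢ κ′ → ψ (κ , b) ≢ ψ (κ′ , b′)
      other-side κ≢κ′ eq = κ≢κ′ (cong proj₁ (ψ-injective eq))
      C = W3.close (ψ (w , x xor y))
            (W3.cons (ψ (v , x)) (ψ-joins x uwv) (λ { (here eq) → u≢w eq ; (there (here eq)) → u≢v eq })
            (W3.cons (ψ (u , y)) (ψ-joins y (distinct-rotate uwv)) (λ { (here eq) → w≢v eq })
            (W3.nil v)))
            u≢v (ψ-joins (x xor y) (distinct-rotate (distinct-rotate uwv)))
            (λ { (here eq) → other-side w≢v eq ; (there (here eq)) → other-side (≢-sym u≢w) eq })

  digons-disjoint : ∀ {κ₁ κ₂} → κ₁ ≢ κ₂ → Disjoint (map ψ (digon κ₁)) (map ψ (digon κ₂))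
  digons-disjoint κ₁≢κ₂ _ e∈₁ e∈₂ =
    κ₁≢κ₂ (cong proj₁ (ψ-injective (trans (sym (proj₂ (on-side e∈₁))) (proj₂ (on-side e∈₂)))))
    where
      on-side : ∀ {e κ} → e ∈ map ψ (digon κ) → Σ Bool λ b → e ≡ ψ (κ , b)
      on-side (here e≡)         = true , e≡
      on-side (there (here e≡)) = false , e≡

  shape-circuit : ∀ {S} s → S ≐ map ψ (shapeEdges s) → FrameCircuit S
  shape-circuit (triangle x y) S≐ with triangle-balanced {v1} {v2} {v0} ((λ ()) , (λ ()) , (λ ())) x y
  ... | C , balanced = balancedCycle C balanced S≐
  shape-circuit (square κ) S≐ with digon-unbalanced (lo κ) | digon-unbalanced (hi κ)
  ... | C₁ , unbalanced₁ | C₂ , unbalanced₂ =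
    tightHandcuff C₁ C₂ unbalanced₁ unbalanced₂ (digons-disjoint lo≢hi)
      (κ , ends-cover (≢-sym lo≢κ) , ends-cover (≢-sym hi≢κ) ,
       λ w w∈₁ w∈₂ → distinct-third (ends-distinct κ) (ends-avoid w∈₁) (ends-avoid w∈₂))
      S≐
    where
      lo≢hi = proj₁ (ends-distinct κ)
      lo≢κ  = proj₁ (proj₂ (ends-distinct κ))
      hi≢κ  = proj₂ (proj₂ (ends-distinct κ))

  InImage : (Edge → Set) → Set
  InImage S = ∀ e → S e → Σ E6 λ d → ψ d ≡ e

  preimage-of : ∀ {S es xs} → InImage S → S ≐ es → xs ⊆ es → Σ (List E6) λ ds → xs ≡ map ψ ds
  preimage-of im S≐ xs⊆es = preimage ψ (λ e e∈ → im e (Equivalence.from (S≐ e) (xs⊆es e∈)))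

  no-loop : ∀ {S es v} → InImage S → S ≐ es → loop v ∉ es
  no-loop im S≐ loop∈ with im _ (Equivalence.from (S≐ _) loop∈)
  ... | d , ψd≡loop = ψ≢loop d _ ψd≡loop

  triangle-meets-cycle : ∀ {u w v vs es g c} → Distinct u w v → Cycle3 vs es g →
                         ¬ (∀ t → t ∈ u ∷ w ∷ v ∷ [] → t ∈ vs → t ≡ c)
  triangle-meets-cycle uwv C only with cycle-two-vertices C
  ... | x , y , x≢y , x∈ , y∈ =
    x≢y (trans (only x (distinct-covers uwv x) x∈) (sym (only y (distinct-covers uwv y) y∈)))

  digon-member : ∀ {κ b b′} → b ≢ b′ → ψ (κ , true) ∈ map ψ ((κ , b′) ∷ (κ , b) ∷ [])
  digon-member b≢b′ = map⁺ ψ (proj₂ (digon-≋ b≢b′)) (here refl)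

  handcuff-shape : ∀ {S vs₁ ds₁ g₁ vs₂ ds₂ g₂ c} → Cycle3 vs₁ (map ψ ds₁) g₁ → Cycle3 vs₂ (map ψ ds₂) g₂ →
    Disjoint (map ψ ds₁) (map ψ ds₂) → (∀ w → w ∈ vs₁ → w ∈ vs₂ → w ≡ c) →
    S ≐ (map ψ ds₁ ++ map ψ ds₂) → Σ Shape λ s → S ≐ map ψ (shapeEdges s)
  handcuff-shape C₁ C₂ disjoint only S≐ with cycle-shape C₁ | cycle-shape C₂
  ... | triangle-cycle uwv | _ = ⊥-elim (triangle-meets-cycle uwv C₂ only)
  ... | _ | triangle-cycle uwv = ⊥-elim (triangle-meets-cycle uwv C₁ (λ t t∈₂ t∈₁ → only t t∈₁ t∈₂))
  ... | digon-cycle {κ = κ₁} b₁≢b₁′ | digon-cycle {κ = κ₂} b₂≢b₂′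
    with satisfied (two-digons-shape κ₁ κ₂ (λ { refl → disjoint _ (digon-member b₁≢b₁′) (digon-member b₂≢b₂′) }))
  ... | s , ≋s = s , ≐-resp-≋ (≐-resp-≋ S≐ (++-≋ (map-≋ ψ (digon-≋ b₁≢b₁′)) (map-≋ ψ (digon-≋ b₂≢b₂′))))
                               (map-≋ ψ ≋s)

  circuit-shape : ∀ {S} → InImage S → FrameCircuit S → Σ Shape λ s → S ≐ map ψ (shapeEdges s)
  circuit-shape im (balancedCycle (loopC _) () _)
  circuit-shape im (balancedCycle (longC C) balanced S≐) with preimage-of im S≐ id
  ... | ds , refl with cycle-shape C
  ...   | digon-cycle {κ = κ} b≢b′ =
    contradiction (trans (cong bit (sym (digon-parity {κ} b≢b′))) (trans (sym (cycle-gain C)) balanced)) p≢ε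
  ...   | triangle-cycle uwv
    with satisfied (even-triangle-shape _ _ _ _ _ _ uwv (bit≡ε (trans (sym (cycle-gain C)) balanced)))
  ...     | s , ≋s = s , ≐-resp-≋ S≐ (map-≋ ψ ≋s)
  circuit-shape im (tightHandcuff (loopC _) _ _ _ _ _ S≐) = ⊥-elim (no-loop im S≐ (here refl))
  circuit-shape im (tightHandcuff {es₁ = es₁} (longC _) (loopC _) _ _ _ _ S≐) =
    ⊥-elim (no-loop im S≐ (∈-++⁺ʳ es₁ (here refl)))
  circuit-shape im (tightHandcuff {es₁ = es₁} (longC C₁) (longC C₂) _ _ disjoint (_ , _ , _ , only) S≐)
    with preimage-of im S≐ (xs⊆xs++ys es₁ _) | preimage-of im S≐ (xs⊆ys++xs _ es₁)
  ... | ds₁ , refl | ds₂ , refl = handcuff-shape C₁ C₂ disjoint only S≐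
  circuit-shape im (looseHandcuff (loopC _) _ _ _ _ _ _ _ _ _ S≐) = ⊥-elim (no-loop im S≐ (here refl))
  circuit-shape im (looseHandcuff {es₁ = es₁} (longC _) (loopC _) _ _ _ _ _ _ _ _ S≐) =
    ⊥-elim (no-loop im S≐ (∈-++⁺ʳ es₁ (here refl)))
  circuit-shape im (looseHandcuff (longC C₁) (longC C₂) _ _ disjoint _ _ _ _ _ _)
    with cycle-two-vertices C₁ | cycle-two-vertices C₂
  ... | x₁ , y₁ , x₁≢y₁ , x₁∈ , y₁∈ | x₂ , y₂ , x₂≢y₂ , x₂∈ , y₂∈ =
    ⊥-elim (no-disjoint-vertex-pairs x₁≢y₁ x₂≢y₂
      (λ { (here refl) → disjoint _ x₁∈ x₂∈ ; (there (here refl)) → disjoint _ y₁∈ x₂∈ })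
      (λ { (here refl) → disjoint _ x₁∈ y₂∈ ; (there (here refl)) → disjoint _ y₁∈ y₂∈ }))
  circuit-shape im (contraTheta {es₁ = es₁} {es₂ = es₂} u≢v P₁ P₂ P₃ i₁₂ i₁₃ i₂₃ dj₁₂ dj₁₃ dj₂₃ unbalanced S≐)
    with preimage-of im S≐ (xs⊆xs++ys es₁ _)
       | preimage-of im S≐ (λ e∈ → xs⊆ys++xs _ es₁ (xs⊆xs++ys es₂ _ e∈))
       | preimage-of im S≐ (λ e∈ → xs⊆ys++xs _ es₁ (xs⊆ys++xs _ es₂ e∈))
  ... | ds₁ , refl | ds₂ , refl | ds₃ , refl =
    ⊥-elim (no-unbalanced-theta u≢v P₁ P₂ P₃ i₁₂ i₁₃ i₂₃ dj₁₂ dj₁₃ dj₂₃ unbalanced)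

  fromE4 : E4 → E6
  fromE4 e = proj₁ (toE4-surjective e)

  φ : E4 → Edge
  φ = ψ ∘ fromE4

  φ-injective : Injective _≡_ _≡_ φ
  φ-injective {e} {e′} φe≡φe′ =
    trans (sym (proj₂ (toE4-surjective e))) (trans (cong toE4 (ψ-injective φe≡φe′)) (proj₂ (toE4-surjective e′)))

  map-φ-toE4 : ∀ ds → map φ (map toE4 ds) ≡ map ψ ds
  map-φ-toE4 ds =
    trans (sym (map-∘ ds)) (map-cong (λ d → cong ψ (toE4-injective (proj₂ (toE4-surjective (toE4 d))))) ds)

  circuits-correspond : ∀ (P : E4 → Set) → K4Circuit P ⇔ FrameCircuit (Image φ P)
  circuits-correspond P = mk⇔
    (λ k4 → let s , P≐ = Equivalence.to k4-circuit⇔shape k4 in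
      shape-circuit s (subst (Image φ P ≐_) (map-φ-toE4 (shapeEdges s)) (Equivalence.to (image-≐ φ-injective) P≐)))
    (λ fm → let s , I≐ = circuit-shape (λ { e (d , _ , φd≡e) → fromE4 d , φd≡e }) fm in
      Equivalence.from k4-circuit⇔shape
        (s , Equivalence.from (image-≐ φ-injective) (subst (Image φ P ≐_) (sym (map-φ-toE4 (shapeEdges s))) I≐)))

  hasMK4Submatroid : ∀ G → (∀ d → G (ψ d) ≡ true) → HasMK4Submatroid G
  hasMK4Submatroid G ψ-in-G = φ , φ-injective , ψ-in-G ∘ fromE4 , λ T →
    let open Equivalence (circuits-correspond (λ d → T d ≡ true)) in
    mk⇔ (λ k4 → (λ { _ (d , _ , refl) → ψ-in-G (fromE4 d) }) , to k4) (from ∘ proj₂)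

-- Labels of a (4,3,2)-triangle

opaque
  four-labels-exhaust : ∀ (y₁ y₂ y₃ y₄ : Γ) → Unique (y₁ ∷ y₂ ∷ y₃ ∷ y₄ ∷ []) → ∀ x → x ∈ y₁ ∷ y₂ ∷ y₃ ∷ y₄ ∷ []
  four-labels-exhaust = from-yes (∀-Γ? λ y₁ → ∀-Γ? λ y₂ → ∀-Γ? λ y₃ → ∀-Γ? λ y₄ →
    unique? (y₁ ∷ y₂ ∷ y₃ ∷ y₄ ∷ []) →-dec ∀-Γ? λ x → x ∈? (y₁ ∷ y₂ ∷ y₃ ∷ y₄ ∷ []))
    where open UniqueDec _≟Γ_ using (unique?)
          open MembershipDec _≟Γ_ using (_∈?_)

  three-labels-coset : ∀ (c₁ c₂ c₃ q : Γ) → Unique (c₁ ∷ c₂ ∷ c₃ ∷ []) → q ≢ ε →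
                       Σ Γ λ c → c ∈ c₁ ∷ c₂ ∷ c₃ ∷ [] × c · q ∈ c₁ ∷ c₂ ∷ c₃ ∷ []
  three-labels-coset = from-yes (∀-Γ? λ c₁ → ∀-Γ? λ c₂ → ∀-Γ? λ c₃ → ∀-Γ? λ q →
    unique? (c₁ ∷ c₂ ∷ c₃ ∷ []) →-dec ¬? (q ≟Γ ε) →-dec
    ∃-Γ? λ c → c ∈? (c₁ ∷ c₂ ∷ c₃ ∷ []) ×-dec c · q ∈? (c₁ ∷ c₂ ∷ c₃ ∷ []))
    where open UniqueDec _≟Γ_ using (unique?)
          open MembershipDec _≟Γ_ using (_∈?_)

module _ {G : Subgraph} {u v : V3} where

  two-labels : LabelsAtLeast G u v 2 → Σ Γ λ e → Σ Γ λ q → q ≢ ε × InLabel G u v e × InLabel G u v (e · q)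
  two-labels ([] , () , _)
  two-labels (_ ∷ [] , () , _)
  two-labels (_ ∷ _ ∷ _ ∷ _ , () , _)
  two-labels (x₁ ∷ x₂ ∷ [] , refl , (x₁≢x₂ ∷ []) ∷ _ , ℓx₁ ∷ ℓx₂ ∷ []) =
    x₁ , x₁ · x₂ , x₁≢x₂ ∘ ·≡ε⇒≡ x₁ x₂ , ℓx₁ , subst (InLabel G u v) (sym (·-absorb x₁ x₂)) ℓx₂

  coset-in-labels : LabelsAtLeast G u v 3 → ∀ q → q ≢ ε → Σ Γ λ c → InLabel G u v c × InLabel G u v (c · q)
  coset-in-labels ([] , () , _)
  coset-in-labels (_ ∷ [] , () , _)
  coset-in-labels (_ ∷ _ ∷ [] , () , _)
  coset-in-labels (_ ∷ _ ∷ _ ∷ _ ∷ _ , () , _)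
  coset-in-labels (c₁ ∷ c₂ ∷ c₃ ∷ [] , refl , unique , ℓs) q q≢ε with three-labels-coset c₁ c₂ c₃ q unique q≢ε
  ... | c , c∈ , cq∈ = c , All.lookup ℓs c∈ , All.lookup ℓs cq∈

  all-labels : LabelsAtLeast G u v 4 → ∀ x → InLabel G u v x
  all-labels ([] , () , _)
  all-labels (_ ∷ [] , () , _)
  all-labels (_ ∷ _ ∷ [] , () , _)
  all-labels (_ ∷ _ ∷ _ ∷ [] , () , _)
  all-labels (_ ∷ _ ∷ _ ∷ _ ∷ _ ∷ _ , () , _)
  all-labels (y₁ ∷ y₂ ∷ y₃ ∷ y₄ ∷ [] , refl , unique , ℓs) x =
    All.lookup ℓs (four-labels-exhaust y₁ y₂ y₃ y₄ unique x)

  inLabel-sym : ∀ {x} → InLabel G u v x → InLabel G v u x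
  inLabel-sym (inj₁ ℓ) = inj₂ ℓ
  inLabel-sym (inj₂ ℓ) = inj₁ ℓ

  inLabel-arc : ∀ {x} (u<v : u < v) → InLabel G u v x → G (arc u v u<v x) ≡ true
  inLabel-arc _   (inj₁ (_ , Gx))  = Gx
  inLabel-arc u<v (inj₂ (v<u , _)) = contradiction v<u (<-asym u<v)

module LabelledTriangle (G : Subgraph) {i j k : V3} (ijk : Distinct i j k) (c e q : Γ) (q≢ε : q ≢ ε)
  (ij-all : ∀ x → InLabel G i j x)
  (ik-coset : InLabel G i k c × InLabel G i k (c · q))
  (jk-coset : InLabel G j k e × InLabel G j k (e · q)) where

  -- Chosen so that potential i · potential k = c and potential j · potential k = e.
  potential : V3 → Γ
  potential t with t ≟ i | t ≟ j
  ... | yes _ | _     = c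
  ... | no _  | yes _ = e
  ... | no _  | no _  = ε

  potential-i : potential i ≡ c
  potential-i with i ≟ i
  ... | yes _  = refl
  ... | no i≢i = contradiction refl i≢i

  potential-j : potential j ≡ e
  potential-j with j ≟ i | j ≟ j
  ... | yes j≡i | _      = contradiction (sym j≡i) (proj₁ ijk)
  ... | no _    | yes _  = refl
  ... | no _    | no j≢j = contradiction refl j≢j

  potential-k : potential k ≡ ε
  potential-k with k ≟ i | k ≟ j
  ... | yes k≡i | _       = contradiction (sym k≡i) (proj₁ (proj₂ ijk))
  ... | no _    | yes k≡j = contradiction (sym k≡j) (proj₂ (proj₂ ijk))
  ... | no _    | no _    = refl

  open DoubledTriangle potential q q≢ε

  coset-label : ∀ {x y ℓ} → InLabel G x y ℓ × InLabel G x y (ℓ · q) → potential x · potential y ≡ ℓ →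
                ∀ b → InLabel G x y (gainVia x b y)
  coset-label (ℓ∈ , _)  pot≡ℓ false = subst (InLabel G _ _) (sym (trans (·-identityʳ _) pot≡ℓ)) ℓ∈
  coset-label (_ , ℓq∈) pot≡ℓ true  = subst (InLabel G _ _) (sym (cong (_· q) pot≡ℓ)) ℓq∈

  label-via-pair : ∀ {a b x y κ β} → Distinct a b κ → Distinct x y κ →
                   InLabel G x y (gainVia x β y) → InLabel G a b (gainVia a β b)
  label-via-pair {a} {b} {β = β} abκ xyκ ℓ∈ with same-pair abκ xyκ
  ... | inj₁ (refl , refl) = ℓ∈
  ... | inj₂ (refl , refl) = subst (InLabel G a b) (gainVia-sym b β a) (inLabel-sym {G} ℓ∈)

  doubled-triangle-labels : ∀ κ b → InLabel G (lo κ) (hi κ) (gainVia (lo κ) b (hi κ))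
  doubled-triangle-labels κ b with distinct-covers ijk κ
  ... | here refl =
    label-via-pair {β = b} (ends-distinct κ) (distinct-rotate ijk)
      (coset-label jk-coset (trans (cong₂ _·_ potential-j potential-k) (·-identityʳ e)) b)
  ... | there (here refl) =
    label-via-pair {β = b} (ends-distinct κ) (distinct-swap (distinct-rotate (distinct-rotate ijk)))
      (coset-label ik-coset (trans (cong₂ _·_ potential-i potential-k) (·-identityʳ c)) b)
  ... | there (there (here refl)) = label-via-pair {β = b} (ends-distinct κ) ijk (ij-all _)

  doubled-triangle-in-G : ∀ d → G (ψ d) ≡ true
  doubled-triangle-in-G (κ , b) =
    subst (λ x → G x ≡ true) (sym (ψ-arc κ b)) (inLabel-arc {G} (lo<hi κ) (doubled-triangle-labels κ b))

lemma5p7 : (G : Subgraph) → IsTriangle 4 3 2 G → HasMK4Submatroid G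
lemma5p7 G (i , j , k , i≢j , i≢k , j≢k , ℓij , ℓik , ℓjk) with two-labels {G} ℓjk
... | e , q , q≢ε , jk-coset with coset-in-labels {G} ℓik q q≢ε
... | c , ik-coset = DoubledTriangle.hasMK4Submatroid potential q q≢ε G doubled-triangle-in-G
  where open LabelledTriangle G (i≢j , i≢k , j≢k) c e q q≢ε (all-labels {G} ℓij) ik-coset jk-coset
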